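{- Let $G$ be a connected graph with vertex set $V(G)=\{v_1,\dots,v_n\}$ and $\delta(G)\ge 2$. Let $H$ be a connected factor of $G$ with $1\le \deg_H(v_i)<\deg_G(v_i)$ for all $1\le i\le n$, and let $B=(b_1,\dots,b_n)$ be a sequence with $b_i\in\{0,1\}$ containing an even number of ones. Then $G$ has a $B$-factor, i.e., a factor $F$ of $G$ with $\deg_F(v_i)\equiv b_i \pmod 2$ for all $1\le i\le n$.
   Context: Graphs may have loops and multiple edges; the degree $\deg_G(v)$ counts each loop twice. A factor of $G$ is a spanning subgraph $H$ of $G$ with minimum degree $\delta(H)\ge 1$. For a binary sequence $B=(b_1,\dots,b_n)$ with an even number of ones, a $B$-factor of $G$ is a factor $F$ whose binary degree sequence $(\deg_F(v_1)\bmod 2,\dots,\deg_F(v_n)\bmod 2)$ equals $B$. -}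

module Defs where

open import Data.Nat using (ℕ; zero; suc; _+_; _≤_; _<_; _%_)
open import Data.Fin using (Fin; zero; suc)
open import Data.Fin.Properties using (_≟_)
open import Data.Bool using (Bool; true; false; if_then_else_)
open import Data.Product using (_×_; _,_; proj₁; proj₂; Σ; ∃)
open import Data.Sum using (_⊎_)
open import Relation.Nullary using (does)
open import Relation.Binary.PropositionalEquality using (_≡_)

∑ : ∀ {m} → (Fin m → ℕ) → ℕ
∑ {zero}  f = 0
∑ {suc m} f = f zero + ∑ (λ i → f (suc i))

-- A multigraph on the vertex set Fin n (vertex v_{i+1} is 'i') with m edges;
-- edge e has endpoints proj₁ (ends e) and proj₂ (ends e); loops (u , u) and
-- parallel edges are allowed.
record Graph (n : ℕ) : Set where
  field
    m    : ℕ
    ends : Fin m → Fin n × Fin n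
open Graph public

Sub : ∀ {n} → Graph n → Set
Sub G = Fin (m G) → Bool

full : ∀ {n} (G : Graph n) → Sub G
full G _ = true

-- Number of ends of edge e at v (a loop contributes 2).
incid : ∀ {n} → Fin n × Fin n → Fin n → ℕ
incid (a , b) v = (if does (a ≟ v) then 1 else 0) + (if does (b ≟ v) then 1 else 0)

deg : ∀ {n} (G : Graph n) → Sub G → Fin n → ℕ
deg G S v = ∑ (λ e → if S e then incid (ends G e) v else 0)

MinDeg≥ : ∀ {n} (G : Graph n) → Sub G → ℕ → Set
MinDeg≥ G S k = ∀ v → k ≤ deg G S v

IsFactor : ∀ {n} (G : Graph n) → Sub G → Set
IsFactor G S = MinDeg≥ G S 1

data Walk {n} (G : Graph n) (S : Sub G) : Fin n → Fin n → Set where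
  here : ∀ {u} → Walk G S u u
  step : ∀ {u w} (e : Fin (m G)) → S e ≡ true →
         (proj₁ (ends G e) ≡ u × proj₂ (ends G e) ≡ w
          ⊎ proj₂ (ends G e) ≡ u × proj₁ (ends G e) ≡ w) →
         ∀ {z} → Walk G S w z → Walk G S u z

Connected : ∀ {n} (G : Graph n) → Sub G → Set
Connected G S = ∀ u w → Walk G S u w

ones : ∀ {n} → (Fin n → Bool) → ℕ
ones B = ∑ (λ i → if B i then 1 else 0)

toℕᵇ : Bool → ℕ
toℕᵇ true = 1
toℕᵇ false = 0

IsBFactor : ∀ {n} (G : Graph n) → (Fin n → Bool) → Sub G → Set
IsBFactor G B F = IsFactor G F × (∀ v → deg G F v % 2 ≡ toℕᵇ (B v))

module Submission where

-- Work over GF(2), encoded as Bool with _xor_ and _∧_.  Let R be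
-- the complement of H in G.  Since deg_H v < deg_G v, R is itself a factor.
-- Its odd-degree vertices differ from the prescribed ones B on a vertex set
-- T = odd(deg_R) ⊕ B, and T is even because B is even (hypothesis) and the set
-- of odd-degree vertices of any subgraph is even (handshake lemma).  As H is
-- connected, T is the odd-degree set of a subgraph J of H (a T-join): the
-- mod-2 sum of walks in H from a fixed root to every vertex of T.  Then
-- F = R ⊕ J contains R, hence is a factor, and has odd-degree set B.

open import Defs
open import Data.Nat using (ℕ; zero; suc; _+_; _≤_; _<_; _%_; z≤n)
open import Data.Nat.Properties
  using (+-comm; +-identityʳ; ≤-refl; ≤-trans; +-mono-≤; +-cancelˡ-<; +-commutativeSemigroup)
open import Data.Nat.DivMod using ([m+n]%n≡m%n)
open import Data.Fin using (Fin; zero; suc)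
open import Data.Fin.Properties using (_≟_)
open import Data.Bool using (Bool; true; false; not; _∧_; _xor_; if_then_else_)
open import Data.Bool.Properties
  using ( xor-same; xor-comm; xor-assoc; xor-identityʳ; xor-∧-commutativeRing
        ; ∧-zeroʳ; ∧-identityʳ; ∧-comm; ∧-assoc; ∧-distribˡ-xor; ∧-distribʳ-xor
        ; not-involutive; not-injective; not-distribˡ-xor )
open import Algebra.Bundles using (CommutativeRing)
open import Algebra.Properties.CommutativeSemigroup
  (CommutativeRing.+-commutativeSemigroup xor-∧-commutativeRing)
  using () renaming (interchange to xor-interchange)
open import Algebra.Properties.CommutativeSemigroup +-commutativeSemigroup
  using () renaming (interchange to +-interchange)
open import Data.Product using (_×_; Σ; _,_; proj₁; proj₂)
open import Data.Sum using (_⊎_; inj₁; inj₂)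
open import Relation.Nullary using (does; yes; no; contradiction)
open import Relation.Binary.PropositionalEquality using (_≡_; refl; sym; trans; cong; cong₂; subst₂; module ≡-Reasoning)
open ≡-Reasoning

xor-cancel-middle : ∀ u w z → (u xor w) xor (w xor z) ≡ u xor z
xor-cancel-middle u w z = begin
  (u xor w) xor (w xor z) ≡⟨ xor-assoc u w (w xor z) ⟩
  u xor (w xor (w xor z)) ≡⟨ cong (u xor_) (sym (xor-assoc w w z)) ⟩
  u xor ((w xor w) xor z) ≡⟨ cong (λ y → u xor (y xor z)) (xor-same w) ⟩
  u xor z                 ∎

odd : ℕ → Bool
odd zero    = false
odd (suc n) = not (odd n)

odd-+ : ∀ a b → odd (a + b) ≡ odd a xor odd b
odd-+ zero    b = refl
odd-+ (suc a) b = trans (cong not (odd-+ a b)) (not-distribˡ-xor (odd a) (odd b))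

odd-%2 : ∀ n → n % 2 ≡ toℕᵇ (odd n)
odd-%2 zero          = refl
odd-%2 (suc zero)    = refl
odd-%2 (suc (suc n)) = begin
  (2 + n) % 2            ≡⟨ cong (_% 2) (+-comm 2 n) ⟩
  (n + 2) % 2            ≡⟨ [m+n]%n≡m%n n 2 ⟩
  n % 2                  ≡⟨ odd-%2 n ⟩
  toℕᵇ (odd n)           ≡⟨ cong toℕᵇ (sym (not-involutive (odd n))) ⟩
  toℕᵇ (odd (2 + n))     ∎

_≡ᵇ_ : ∀ {m} → Fin m → Fin m → Bool
a ≡ᵇ b = does (a ≟ b)

≡ᵇ-sym : ∀ {m} (a b : Fin m) → (a ≡ᵇ b) ≡ (b ≡ᵇ a)
≡ᵇ-sym a b with a ≟ b | b ≟ a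
... | yes _   | yes _   = refl
... | no _    | no _    = refl
... | yes a≡b | no b≢a  = contradiction (sym a≡b) b≢a
... | no a≢b  | yes b≡a = contradiction (sym b≡a) a≢b

⨁ : ∀ {m} → (Fin m → Bool) → Bool
⨁ {zero}  f = false
⨁ {suc m} f = f zero xor ⨁ (λ i → f (suc i))

⨁-cong : ∀ {m} {f g : Fin m → Bool} → (∀ i → f i ≡ g i) → ⨁ f ≡ ⨁ g
⨁-cong {zero}  f≗g = refl
⨁-cong {suc m} f≗g = cong₂ _xor_ (f≗g zero) (⨁-cong (λ i → f≗g (suc i)))

⨁-zero : ∀ {m} (f : Fin m → Bool) → (∀ i → f i ≡ false) → ⨁ f ≡ false
⨁-zero {zero}  f f≗0 = refl
⨁-zero {suc m} f f≗0 rewrite f≗0 zero = ⨁-zero _ (λ i → f≗0 (suc i))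

⨁-xor : ∀ {m} (f g : Fin m → Bool) → ⨁ (λ i → f i xor g i) ≡ ⨁ f xor ⨁ g
⨁-xor {zero}  f g = refl
⨁-xor {suc m} f g =
  trans (cong ((f zero xor g zero) xor_) (⨁-xor (λ i → f (suc i)) (λ i → g (suc i))))
        (xor-interchange (f zero) (g zero) _ _)

⨁-∧ˡ : ∀ {m} b (f : Fin m → Bool) → ⨁ (λ i → b ∧ f i) ≡ b ∧ ⨁ f
⨁-∧ˡ {zero}  b f = sym (∧-zeroʳ b)
⨁-∧ˡ {suc m} b f =
  trans (cong ((b ∧ f zero) xor_) (⨁-∧ˡ b (λ i → f (suc i))))
        (sym (∧-distribˡ-xor b (f zero) _))

⨁-∧ʳ : ∀ {m} b (f : Fin m → Bool) → ⨁ (λ i → f i ∧ b) ≡ ⨁ f ∧ b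
⨁-∧ʳ {zero}  b f = refl
⨁-∧ʳ {suc m} b f =
  trans (cong ((f zero ∧ b) xor_) (⨁-∧ʳ b (λ i → f (suc i))))
        (sym (∧-distribʳ-xor b (f zero) _))

⨁-swap : ∀ {m k} (f : Fin m → Fin k → Bool) →
  ⨁ (λ i → ⨁ (λ j → f i j)) ≡ ⨁ (λ j → ⨁ (λ i → f i j))
⨁-swap {zero}  f = sym (⨁-zero (λ j → ⨁ (λ (i : Fin zero) → f i j)) (λ _ → refl))
⨁-swap {suc m} f =
  trans (cong (⨁ (f zero) xor_) (⨁-swap (λ i → f (suc i))))
        (sym (⨁-xor (f zero) (λ j → ⨁ (λ i → f (suc i) j))))

⨁-pick : ∀ {m} (f : Fin m → Bool) (x : Fin m) → ⨁ (λ v → f v ∧ (v ≡ᵇ x)) ≡ f x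
⨁-pick f zero = begin
  (f zero ∧ true) xor ⨁ (λ i → f (suc i) ∧ false) ≡⟨ cong₂ _xor_ (∧-identityʳ (f zero)) (⨁-zero _ (λ i → ∧-zeroʳ (f (suc i)))) ⟩
  f zero xor false                                ≡⟨ xor-identityʳ (f zero) ⟩
  f zero                                          ∎
⨁-pick f (suc x) =
  trans (cong (_xor ⨁ (λ v → f (suc v) ∧ (v ≡ᵇ x))) (∧-zeroʳ (f zero)))
        (⨁-pick (λ i → f (suc i)) x)

∑-cong : ∀ {k} {f g : Fin k → ℕ} → (∀ i → f i ≡ g i) → ∑ f ≡ ∑ g
∑-cong {zero}  f≗g = refl
∑-cong {suc k} f≗g = cong₂ _+_ (f≗g zero) (∑-cong (λ i → f≗g (suc i)))

∑-+ : ∀ {k} (f g : Fin k → ℕ) → ∑ (λ i → f i + g i) ≡ ∑ f + ∑ g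
∑-+ {zero}  f g = refl
∑-+ {suc k} f g = trans (cong (f zero + g zero +_) (∑-+ (λ i → f (suc i)) (λ i → g (suc i))))
                        (+-interchange (f zero) (g zero) _ _)

∑-mono : ∀ {k} {f g : Fin k → ℕ} → (∀ i → f i ≤ g i) → ∑ f ≤ ∑ g
∑-mono {zero}  f≤g = z≤n
∑-mono {suc k} f≤g = +-mono-≤ (f≤g zero) (∑-mono (λ i → f≤g (suc i)))

odd-∑ : ∀ {m} (f : Fin m → ℕ) → odd (∑ f) ≡ ⨁ (λ i → odd (f i))
odd-∑ {zero}  f = refl
odd-∑ {suc m} f = trans (odd-+ (f zero) _) (cong (odd (f zero) xor_) (odd-∑ (λ i → f (suc i))))

odd-if : ∀ b w → odd (if b then w else 0) ≡ b ∧ odd w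
odd-if true  w = refl
odd-if false w = refl

odd-indicator : ∀ b → odd (if b then 1 else 0) ≡ b
odd-indicator true  = refl
odd-indicator false = refl

odd-incid : ∀ {n} (a b x : Fin n) → odd (incid (a , b) x) ≡ (a ≡ᵇ x) xor (b ≡ᵇ x)
odd-incid a b x =
  trans (odd-+ (if a ≡ᵇ x then 1 else 0) _)
        (cong₂ _xor_ (odd-indicator (a ≡ᵇ x)) (odd-indicator (b ≡ᵇ x)))

module _ {n} (G : Graph n) where

  oddDeg : Sub G → Fin n → Bool
  oddDeg S x = odd (deg G S x)

  inc : Fin (m G) → Fin n → Bool
  inc e x = odd (incid (ends G e) x)

  oddDeg-⨁ : ∀ S x → oddDeg S x ≡ ⨁ (λ e → S e ∧ inc e x)
  oddDeg-⨁ S x = trans (odd-∑ (λ e → if S e then incid (ends G e) x else 0))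
                       (⨁-cong (λ e → odd-if (S e) (incid (ends G e) x)))

  oddDeg-xor : ∀ (S₁ S₂ : Sub G) x →
    oddDeg (λ e → S₁ e xor S₂ e) x ≡ oddDeg S₁ x xor oddDeg S₂ x
  oddDeg-xor S₁ S₂ x = begin
    oddDeg (λ e → S₁ e xor S₂ e) x                      ≡⟨ oddDeg-⨁ _ x ⟩
    ⨁ (λ e → (S₁ e xor S₂ e) ∧ inc e x)                 ≡⟨ ⨁-cong (λ e → ∧-distribʳ-xor (inc e x) (S₁ e) (S₂ e)) ⟩
    ⨁ (λ e → (S₁ e ∧ inc e x) xor (S₂ e ∧ inc e x))     ≡⟨ ⨁-xor (λ e → S₁ e ∧ inc e x) (λ e → S₂ e ∧ inc e x) ⟩
    ⨁ (λ e → S₁ e ∧ inc e x) xor ⨁ (λ e → S₂ e ∧ inc e x) ≡˘⟨ cong₂ _xor_ (oddDeg-⨁ S₁ x) (oddDeg-⨁ S₂ x) ⟩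
    oddDeg S₁ x xor oddDeg S₂ x                          ∎

  oddDeg-combination : ∀ {k} (c : Fin k → Bool) (S : Fin k → Sub G) x →
    oddDeg (λ e → ⨁ (λ i → c i ∧ S i e)) x ≡ ⨁ (λ i → c i ∧ oddDeg (S i) x)
  oddDeg-combination c S x = begin
    oddDeg (λ e → ⨁ (λ i → c i ∧ S i e)) x           ≡⟨ oddDeg-⨁ _ x ⟩
    ⨁ (λ e → ⨁ (λ i → c i ∧ S i e) ∧ inc e x)        ≡˘⟨ ⨁-cong (λ e → ⨁-∧ʳ (inc e x) (λ i → c i ∧ S i e)) ⟩
    ⨁ (λ e → ⨁ (λ i → (c i ∧ S i e) ∧ inc e x))      ≡⟨ ⨁-cong (λ e → ⨁-cong (λ i → ∧-assoc (c i) (S i e) (inc e x))) ⟩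
    ⨁ (λ e → ⨁ (λ i → c i ∧ (S i e ∧ inc e x)))      ≡⟨ ⨁-swap (λ e i → c i ∧ (S i e ∧ inc e x)) ⟩
    ⨁ (λ i → ⨁ (λ e → c i ∧ (S i e ∧ inc e x)))      ≡⟨ ⨁-cong (λ i → ⨁-∧ˡ (c i) (λ e → S i e ∧ inc e x)) ⟩
    ⨁ (λ i → c i ∧ ⨁ (λ e → S i e ∧ inc e x))        ≡˘⟨ ⨁-cong (λ i → cong (c i ∧_) (oddDeg-⨁ (S i) x)) ⟩
    ⨁ (λ i → c i ∧ oddDeg (S i) x)                    ∎

  handshake : ∀ S → ⨁ (oddDeg S) ≡ false
  handshake S = begin
    ⨁ (oddDeg S)                                ≡⟨ ⨁-cong (oddDeg-⨁ S) ⟩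
    ⨁ (λ v → ⨁ (λ e → S e ∧ inc e v))           ≡⟨ ⨁-swap (λ v e → S e ∧ inc e v) ⟩
    ⨁ (λ e → ⨁ (λ v → S e ∧ inc e v))           ≡⟨ ⨁-zero _ (λ e → trans (⨁-∧ˡ (S e) (inc e)) (edge-term e)) ⟩
    false                                        ∎
    where
    endpoint : ∀ a → ⨁ (λ v → a ≡ᵇ v) ≡ true
    endpoint a = trans (⨁-cong (λ v → ≡ᵇ-sym a v)) (⨁-pick (λ _ → true) a)

    -- Each edge has two ends, so it is incident to an even number of vertices.
    edge-even : ∀ e → ⨁ (inc e) ≡ false
    edge-even e with ends G e
    ... | a , b = begin
      ⨁ (λ v → odd (incid (a , b) v))       ≡⟨ ⨁-cong (odd-incid a b) ⟩
      ⨁ (λ v → (a ≡ᵇ v) xor (b ≡ᵇ v))       ≡⟨ ⨁-xor (a ≡ᵇ_) (b ≡ᵇ_) ⟩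
      ⨁ (λ v → a ≡ᵇ v) xor ⨁ (λ v → b ≡ᵇ v) ≡⟨ cong₂ _xor_ (endpoint a) (endpoint b) ⟩
      false                                  ∎

    edge-term : ∀ e → S e ∧ ⨁ (inc e) ≡ false
    edge-term e = trans (cong (S e ∧_) (edge-even e)) (∧-zeroʳ (S e))

  oddDeg-edge : ∀ e x → oddDeg (λ e′ → e ≡ᵇ e′) x ≡ inc e x
  oddDeg-edge e x = begin
    oddDeg (λ e′ → e ≡ᵇ e′) x               ≡⟨ oddDeg-⨁ _ x ⟩
    ⨁ (λ e′ → (e ≡ᵇ e′) ∧ inc e′ x)         ≡⟨ ⨁-cong (λ e′ → trans (cong (_∧ inc e′ x) (≡ᵇ-sym e e′)) (∧-comm _ (inc e′ x))) ⟩
    ⨁ (λ e′ → inc e′ x ∧ (e′ ≡ᵇ e))         ≡⟨ ⨁-pick (λ e′ → inc e′ x) e ⟩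
    inc e x                                  ∎

  inc-joining : ∀ e {u w} →
    (proj₁ (ends G e) ≡ u × proj₂ (ends G e) ≡ w ⊎ proj₂ (ends G e) ≡ u × proj₁ (ends G e) ≡ w) →
    ∀ x → inc e x ≡ (u ≡ᵇ x) xor (w ≡ᵇ x)
  inc-joining e (inj₁ (refl , refl)) x = odd-incid (proj₁ (ends G e)) (proj₂ (ends G e)) x
  inc-joining e (inj₂ (refl , refl)) x =
    trans (odd-incid (proj₁ (ends G e)) (proj₂ (ends G e)) x)
          (xor-comm (proj₁ (ends G e) ≡ᵇ x) (proj₂ (ends G e) ≡ᵇ x))

  -- The edges used an odd number of times by a walk.
  walkEdges : ∀ {S u z} → Walk G S u z → Sub G
  walkEdges here              = λ _ → false
  walkEdges (step e _ _ rest) = λ e′ → (e ≡ᵇ e′) xor walkEdges rest e′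

  walkEdges-oddDeg : ∀ {S u z} (p : Walk G S u z) x →
    oddDeg (walkEdges p) x ≡ (u ≡ᵇ x) xor (z ≡ᵇ x)
  walkEdges-oddDeg {u = u} here x = begin
    oddDeg (λ _ → false) x         ≡⟨ oddDeg-⨁ (λ _ → false) x ⟩
    ⨁ (λ (e : Fin (m G)) → false)  ≡⟨ ⨁-zero {m G} (λ _ → false) (λ _ → refl) ⟩
    false                          ≡˘⟨ xor-same (u ≡ᵇ x) ⟩
    (u ≡ᵇ x) xor (u ≡ᵇ x)          ∎
  walkEdges-oddDeg {u = u} {z} (step {w = w} e on joins rest) x = begin
    oddDeg (walkEdges (step e on joins rest)) x                ≡⟨ oddDeg-xor (e ≡ᵇ_) (walkEdges rest) x ⟩
    oddDeg (λ e′ → e ≡ᵇ e′) x xor oddDeg (walkEdges rest) x   ≡⟨ cong₂ _xor_ (trans (oddDeg-edge e x) (inc-joining e joins x)) (walkEdges-oddDeg rest x) ⟩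
    ((u ≡ᵇ x) xor (w ≡ᵇ x)) xor ((w ≡ᵇ x) xor (z ≡ᵇ x))       ≡⟨ xor-cancel-middle (u ≡ᵇ x) (w ≡ᵇ x) (z ≡ᵇ x) ⟩
    (u ≡ᵇ x) xor (z ≡ᵇ x)                                     ∎

  walkEdges-within : ∀ {S u z} (p : Walk G S u z) e → S e ≡ false → walkEdges p e ≡ false
  walkEdges-within here              e′ off = refl
  walkEdges-within (step e on _ rest) e′ off with e ≟ e′
  ... | yes refl = contradiction (trans (sym on) off) (λ ())
  ... | no _     = walkEdges-within rest e′ off

  -- J is
  -- the mod-2 sum, over v ∈ T, of a walk in S from r to v; the contributions
  -- of the root cancel because T is even.
  T-join-from : ∀ (S : Sub G) (r : Fin n) → (∀ v → Walk G S r v) →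
    (T : Fin n → Bool) → ⨁ T ≡ false →
    Σ (Sub G) λ J → (∀ e → S e ≡ false → J e ≡ false) × (∀ x → oddDeg J x ≡ T x)
  T-join-from S r walk T even = J , J-within , J-odd
    where
    J : Sub G
    J e = ⨁ (λ v → T v ∧ walkEdges (walk v) e)

    J-within : ∀ e → S e ≡ false → J e ≡ false
    J-within e off = ⨁-zero _ (λ v → trans (cong (T v ∧_) (walkEdges-within (walk v) e off)) (∧-zeroʳ (T v)))

    J-odd : ∀ x → oddDeg J x ≡ T x
    J-odd x = begin
      oddDeg J x                                              ≡⟨ oddDeg-combination T (λ v → walkEdges (walk v)) x ⟩
      ⨁ (λ v → T v ∧ oddDeg (walkEdges (walk v)) x)           ≡⟨ ⨁-cong (λ v → cong (T v ∧_) (walkEdges-oddDeg (walk v) x)) ⟩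
      ⨁ (λ v → T v ∧ ((r ≡ᵇ x) xor (v ≡ᵇ x)))                 ≡⟨ ⨁-cong (λ v → ∧-distribˡ-xor (T v) _ _) ⟩
      ⨁ (λ v → (T v ∧ (r ≡ᵇ x)) xor (T v ∧ (v ≡ᵇ x)))         ≡⟨ ⨁-xor (λ v → T v ∧ (r ≡ᵇ x)) (λ v → T v ∧ (v ≡ᵇ x)) ⟩
      ⨁ (λ v → T v ∧ (r ≡ᵇ x)) xor ⨁ (λ v → T v ∧ (v ≡ᵇ x))    ≡⟨ cong₂ _xor_ (⨁-∧ʳ (r ≡ᵇ x) T) (⨁-pick T x) ⟩
      (⨁ T ∧ (r ≡ᵇ x)) xor T x                                ≡⟨ cong (λ t → (t ∧ (r ≡ᵇ x)) xor T x) even ⟩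
      T x                                                      ∎

  deg-mono : ∀ (S S′ : Sub G) → (∀ e → S e ≡ true → S′ e ≡ true) → ∀ x → deg G S x ≤ deg G S′ x
  deg-mono S S′ S⊆S′ x = ∑-mono (λ e → pointwise (S e) (S′ e) (S⊆S′ e))
    where
    pointwise : ∀ b c {w} → (b ≡ true → c ≡ true) → (if b then w else 0) ≤ (if c then w else 0)
    pointwise false c _   = z≤n
    pointwise true  c b⇒c rewrite b⇒c refl = ≤-refl

  deg-complement : ∀ (H : Sub G) x → deg G (full G) x ≡ deg G H x + deg G (λ e → not (H e)) x
  deg-complement H x =
    trans (∑-cong (λ e → pointwise (H e) (incid (ends G e) x)))
          (∑-+ (λ e → if H e then incid (ends G e) x else 0)
               (λ e → if not (H e) then incid (ends G e) x else 0))
    where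
    pointwise : ∀ b w → w ≡ (if b then w else 0) + (if not b then w else 0)
    pointwise true  w = sym (+-identityʳ w)
    pointwise false w = refl

T-join : ∀ {n} (G : Graph n) (S : Sub G) → Connected G S → (T : Fin n → Bool) → ⨁ T ≡ false →
  Σ (Sub G) λ J → (∀ e → S e ≡ false → J e ≡ false) × (∀ x → oddDeg G J x ≡ T x)
T-join {zero}  G S conn T even = (λ _ → false) , (λ _ _ → refl) , λ ()
T-join {suc n} G S conn T even = T-join-from G S zero (conn zero) T even

⨁-even : ∀ {n} (B : Fin n → Bool) → ones B % 2 ≡ 0 → ⨁ B ≡ false
⨁-even B ones-even = begin
  ⨁ B                                      ≡˘⟨ ⨁-cong (λ i → odd-indicator (B i)) ⟩
  ⨁ (λ i → odd (if B i then 1 else 0))     ≡˘⟨ odd-∑ (λ i → if B i then 1 else 0) ⟩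
  odd (ones B)                             ≡⟨ toℕᵇ≡0 (trans (sym (odd-%2 (ones B))) ones-even) ⟩
  false                                    ∎
  where
  toℕᵇ≡0 : ∀ {b} → toℕᵇ b ≡ 0 → b ≡ false
  toℕᵇ≡0 {false} _ = refl

complement-factor : ∀ {n} (G : Graph n) (H : Sub G) →
  (∀ v → deg G H v < deg G (full G) v) → IsFactor G (λ e → not (H e))
complement-factor G H H<G v =
  +-cancelˡ-< (deg G H v) 0 _
    (subst₂ _<_ (sym (+-identityʳ (deg G H v))) (deg-complement G H v) (H<G v))

parity-correction : ∀ {n} (G : Graph n) (B : Fin n → Bool) (R J : Sub G) →
  IsFactor G R → (∀ e → R e ≡ true → J e ≡ false) →
  (∀ x → oddDeg G J x ≡ oddDeg G R x xor B x) →
  IsBFactor G B (λ e → R e xor J e)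
parity-correction G B R J R-factor J-outside-R J-odd = F-factor , F-parity
  where
  R⊆F : ∀ e → R e ≡ true → R e xor J e ≡ true
  R⊆F e Re = begin
    R e xor J e   ≡⟨ cong (R e xor_) (J-outside-R e Re) ⟩
    R e xor false ≡⟨ xor-identityʳ (R e) ⟩
    R e           ≡⟨ Re ⟩
    true          ∎

  F-factor : IsFactor G (λ e → R e xor J e)
  F-factor x = ≤-trans (R-factor x) (deg-mono G R _ R⊆F x)

  F-parity : ∀ x → deg G (λ e → R e xor J e) x % 2 ≡ toℕᵇ (B x)
  F-parity x = trans (odd-%2 (deg G (λ e → R e xor J e) x)) (cong toℕᵇ (begin
    oddDeg G (λ e → R e xor J e) x            ≡⟨ oddDeg-xor G R J x ⟩
    oddDeg G R x xor oddDeg G J x             ≡⟨ cong (oddDeg G R x xor_) (J-odd x) ⟩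
    oddDeg G R x xor (oddDeg G R x xor B x)   ≡⟨ xor-cancel-middle false (oddDeg G R x) (B x) ⟩
    B x                                       ∎))

mainTheorem4 : ∀ {n : ℕ} (G : Graph n) (H : Sub G) (B : Fin n → Bool) →
    Connected G (full G) →
    MinDeg≥ G (full G) 2 →
    IsFactor G H →
    Connected G H →
    (∀ v → 1 ≤ deg G H v × deg G H v < deg G (full G) v) →
    ones B % 2 ≡ 0 →
    Σ (Sub G) (λ F → IsBFactor G B F)
mainTheorem4 {n} G H B _ _ _ H-connected H-degrees B-even =
  (λ e → R e xor J e) ,
  parity-correction G B R J R-factor (λ e Re → J-within-H e (not-injective Re)) J-odd
  where
  R : Sub G
  R e = not (H e)

  R-factor : IsFactor G R
  R-factor = complement-factor G H (λ v → proj₂ (H-degrees v))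

  T : Fin n → Bool
  T v = oddDeg G R v xor B v

  T-even : ⨁ T ≡ false
  T-even = trans (⨁-xor (oddDeg G R) B) (cong₂ _xor_ (handshake G R) (⨁-even B B-even))

  join : Σ (Sub G) λ J → (∀ e → H e ≡ false → J e ≡ false) × (∀ x → oddDeg G J x ≡ T x)
  join = T-join G H H-connected T T-even

  J : Sub G
  J = proj₁ join

  J-within-H : ∀ e → H e ≡ false → J e ≡ false
  J-within-H = proj₁ (proj₂ join)

  J-odd : ∀ x → oddDeg G J x ≡ T x
  J-odd = proj₂ (proj₂ join)
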